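{- Let $R$ be a finite group and let $\varphi$ be an automorphism of $R$ with $|R:\mathrm{C}_R(\varphi)|=2$. Then one of the following holds: (1) $\frac14\left(|R|+|\mathbf{I}(R)|+|\mathrm{C}_R(\varphi)|+|\mathrm{C}_R(\varphi)^{ -1}|\right)\le \mathbf{c}(R)-\frac{|R|}{32}$; (2) $A:=\mathrm{C}_R(\varphi)$ is abelian of exponent greater than $2$, $R$ is generalized dicyclic over $A$, and $\varphi=\bar\iota_A$; (3) $R$ is abelian of exponent greater than $2$ and $\varphi=\iota$, the inversion map $x\mapsto x^{ -1}$.
   Context: For a finite group $R$: $\mathbf{I}(R)=\{x\in R\mid x^2=1\}$ (elements of order at most $2$), and $\mathbf{c}(R)=(|R|+|\mathbf{I}(R)|)/2$. For an automorphism $\varphi$: $\mathrm{C}_R(\varphi)=\{x\in R\mid x^\varphi=x\}$ and $\mathrm{C}_R(\varphi)^{ -1}=\{x\in R\mid x^\varphi=x^{ -1}\}$ (this is notation for the set of elements inverted by $\varphi$, not the set of inverses). $\iota:R\to R$ is $x\mapsto x^{ -1}$. "$R$ is generalized dicyclic over $A$" means: $A$ is an abelian subgroup of index $2$ in $R$ of exponent greater than $2$, and there is $x\in R\setminus A$ with $x^2$ an involution of $A$ and $x^{ -1}ax=a^{ -1}$ for all $a\in A$ (so $R\cong\mathrm{Dic}(A,x^2,x)$). Then $\bar\iota_A:R\to R$ is the automorphism with $a^{\bar\iota_A}=a$ and $(ax)^{\bar\iota_A}=ax^{ -1}$ for all $a\in A$. -}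

module Defs where

open import Level using (0ℓ)
open import Data.Nat using (ℕ; _+_; _*_; _≤_)
open import Data.Fin using (Fin)
open import Data.Fin.Properties using (_≟_)
open import Data.List using (List; length; filter; allFin)
open import Data.Product using (Σ; ∃; _×_; _,_)
open import Data.Sum using (_⊎_)
open import Relation.Nullary using (¬_; Dec)
open import Relation.Binary.PropositionalEquality using (_≡_)
open import Algebra.Structures using (IsGroup)
open import Function.Definitions using (Bijective)

-- A finite group, presented (up to isomorphism) on the carrier Fin n.
record FinGroup : Set where
  field
    n       : ℕ
    _∙_     : Fin n → Fin n → Fin n
    ε       : Fin n
    _⁻¹     : Fin n → Fin n
    isGroup : IsGroup _≡_ _∙_ ε _⁻¹
  infixl 7 _∙_
  infix 8 _⁻¹

  El : Set
  El = Fin n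

  count : {P : El → Set} → ((x : El) → Dec (P x)) → ℕ
  count P? = length (filter P? (allFin n))

  involCount : ℕ
  involCount = count (λ x → (x ∙ x) ≟ ε)

  IsAutomorphism : (El → El) → Set
  IsAutomorphism φ = (∀ x y → φ (x ∙ y) ≡ φ x ∙ φ y) × Bijective _≡_ _≡_ φ

  centCount : (El → El) → ℕ
  centCount φ = count (λ x → φ x ≟ x)

  invertedCount : (El → El) → ℕ
  invertedCount φ = count (λ x → φ x ≟ x ⁻¹)

open FinGroup public using (n; El; involCount; IsAutomorphism; centCount; invertedCount)

-- alternative (1):  (1/4)(|R|+|I(R)|+|C|+|C^{-1}|) ≤ c(R) - |R|/32,
-- where c(R) = (|R|+|I(R)|)/2;  multiplied through by 32.
Alt1 : (R : FinGroup) → (El R → El R) → Set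
Alt1 R φ =
  8 * (n R + involCount R + centCount R φ + invertedCount R φ) + n R
    ≤ 16 * (n R + involCount R)

Alt2 : (R : FinGroup) → (El R → El R) → Set
Alt2 R φ =
  (∀ a b → InA a → InA b → (a ∙ b) ≡ (b ∙ a))
  × (∃ λ a → InA a × ¬ (a ∙ a ≡ ε))
  -- R is generalized dicyclic over A, witnessed by x, and φ = ῑ_A
  × (∃ λ x → ¬ InA x
       × InA (x ∙ x) × ¬ (x ∙ x ≡ ε) × ((x ∙ x) ∙ (x ∙ x) ≡ ε)
       × (∀ a → InA a → (x ⁻¹ ∙ a ∙ x) ≡ a ⁻¹)
       × (∀ a → InA a → φ a ≡ a)
       × (∀ a → InA a → φ (a ∙ x) ≡ a ∙ x ⁻¹))
  where
    open FinGroup R using (_∙_; ε; _⁻¹)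
    InA : El R → Set
    InA a = φ a ≡ a

Alt3 : (R : FinGroup) → (El R → El R) → Set
Alt3 R φ =
  (∀ a b → (a ∙ b) ≡ (b ∙ a))
  × (∃ λ a → ¬ (a ∙ a ≡ ε))
  × (∀ x → φ x ≡ x ⁻¹)
  where open FinGroup R using (_∙_; ε; _⁻¹)

-- Let A = C_R(φ), a subgroup of index 2. Since the elements of A inverted by φ are involutions,
-- alternative (1) follows as soon as  4 |C⁻¹ ∖ A| ≤ 3 |A| + 4 |I ∖ A|.  If some x ∉ A is inverted
-- by φ, then R = A ∪ A x, and a x (a ∈ A) is inverted by φ exactly when conjugation by x inverts a;
-- so |C⁻¹ ∖ A| is at most the number of elements of A inverted by that conjugation.  If this is at
-- most 3|A|/4 we are done; otherwise the classical ¾-argument (an endomorphism inverting more than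
-- three quarters of a group inverts all of it, and the group is abelian) applies to A.  Then x² = 1
-- makes every element outside A an involution, giving (1); if x² ≠ 1 we get (2) when A has an
-- element of order > 2 and (3) when it has none, as then x centralises A.
module Submission where

open import Level using (0ℓ)
open import Algebra.Bundles using (Group)
open import Algebra.Structures using (IsGroup)
import Algebra.Properties.Group as GroupProperties
open import Data.Empty using (⊥-elim)
open import Data.Fin using (Fin)
open import Data.Fin.Properties using (_≟_; any?)
open import Data.List using (List; []; _∷_; length; filter; allFin; map)
open import Data.List.Properties
  using (length-map; length-removeAt′; length-tabulate; filter-some)
open import Data.List.Membership.Propositional using (_∈_; lose)
open import Data.List.Membership.Propositional.Properties
  using (∈-filter⁺; ∈-filter⁻; ∈-allFin; ∈-map⁻)
open import Data.List.Relation.Unary.Any using (here; there; _─_; index)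
import Data.List.Relation.Unary.All as All
open import Data.List.Relation.Unary.AllPairs using (_∷_)
open import Data.List.Relation.Unary.Unique.Propositional using (Unique)
import Data.List.Relation.Unary.Unique.Propositional.Properties as Unique
open import Data.List.Relation.Binary.Sublist.Propositional using (⊆-refl)
open import Data.List.Relation.Binary.Sublist.Propositional.Properties
  using (filter⁺; length-mono-≤)
open import Data.Nat using (ℕ; suc; _+_; _*_; _≤_; _<_; _≤?_; z≤n; s≤s)
open import Data.Nat.Properties hiding (_≟_)
open import Data.Nat.Tactic.RingSolver using (solve-∀)
open import Data.Product using (∃; _×_; _,_; proj₁; proj₂)
open import Data.Sum using (_⊎_; inj₁; inj₂)
open import Function using (_∘_)
open import Function.Definitions using (Injective)
open import Relation.Binary.PropositionalEquality
open import Relation.Nullary using (¬_; yes; no; decidable-stable)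
open import Relation.Unary using (Pred; Decidable; _⊆_; _∩_; _∖_; ∁; _⊥_)
open import Relation.Unary.Properties using (_∩?_; ∁?)
open import Defs

module _ {A : Set} {P Q : Pred A 0ℓ} (P? : Decidable P) (Q? : Decidable Q) where

  length-filter-mono : P ⊆ Q → ∀ xs → length (filter P? xs) ≤ length (filter Q? xs)
  length-filter-mono P⊆Q xs =
    length-mono-≤ (filter⁺ P? Q? (λ { refl → P⊆Q }) (⊆-refl {x = xs}))

  length-filter-split : ∀ xs → length (filter P? xs) ≡
    length (filter (P? ∩? Q?) xs) + length (filter (P? ∩? ∁? Q?) xs)
  length-filter-split []       = refl
  length-filter-split (x ∷ xs) with P? x | Q? x
  ... | yes _ | yes _ = cong suc (length-filter-split xs)
  ... | yes _ | no  _ = trans (cong suc (length-filter-split xs)) (sym (+-suc _ _))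
  ... | no  _ | _     = length-filter-split xs

module _ {A : Set} {P : Pred A 0ℓ} (P? : Decidable P) where

  length-filter-∁ : ∀ xs → length xs ≡ length (filter P? xs) + length (filter (∁? P?) xs)
  length-filter-∁ []       = refl
  length-filter-∁ (x ∷ xs) with P? x
  ... | yes _ = cong suc (length-filter-∁ xs)
  ... | no  _ = trans (cong suc (length-filter-∁ xs)) (sym (+-suc _ _))

module _ {A : Set} where

  ∈-─ : ∀ {x z : A} {ys} (x∈ys : x ∈ ys) → z ∈ ys → z ≢ x → z ∈ (ys ─ x∈ys)
  ∈-─ (here refl) (here refl) z≢x = ⊥-elim (z≢x refl)
  ∈-─ (here _)    (there z∈)  _   = z∈
  ∈-─ (there _)   (here refl) _   = here refl
  ∈-─ (there x∈)  (there z∈)  z≢x = there (∈-─ x∈ z∈ z≢x)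

  unique-⊆⇒length≤ : ∀ {xs ys : List A} → Unique xs →
                     (∀ {z} → z ∈ xs → z ∈ ys) → length xs ≤ length ys
  unique-⊆⇒length≤ {[]}          _               _     = z≤n
  unique-⊆⇒length≤ {x ∷ xs} {ys} (x∉xs ∷ unique) xs⊆ys = begin
    suc (length xs)          ≤⟨ s≤s (unique-⊆⇒length≤ unique xs⊆ys─x) ⟩
    suc (length (ys ─ x∈ys)) ≡⟨ length-removeAt′ ys (index x∈ys) ⟨
    length ys                ∎
    where
      open ≤-Reasoning
      x∈ys : x ∈ ys
      x∈ys = xs⊆ys (here refl)
      xs⊆ys─x : ∀ {z} → z ∈ xs → z ∈ (ys ─ x∈ys)
      xs⊆ys─x z∈xs =
        ∈-─ x∈ys (xs⊆ys (there z∈xs)) λ { refl → All.lookup x∉xs z∈xs refl }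

module _ {N : ℕ} where

  count : {P : Pred (Fin N) 0ℓ} → Decidable P → ℕ
  count P? = length (filter P? (allFin N))

  module _ {P Q : Pred (Fin N) 0ℓ} (P? : Decidable P) (Q? : Decidable Q) where

    count-mono : P ⊆ Q → count P? ≤ count Q?
    count-mono P⊆Q = length-filter-mono P? Q? P⊆Q (allFin N)

    count-split : count P? ≡ count (P? ∩? Q?) + count (P? ∩? ∁? Q?)
    count-split = length-filter-split P? Q? (allFin N)

    count-injective : ∀ f → Injective _≡_ _≡_ f → (∀ {x} → P x → Q (f x)) →
                      count P? ≤ count Q?
    count-injective f f-injective P⇒Q∘f = begin
      count P?                              ≡⟨ length-map f (filter P? (allFin N)) ⟨
      length (map f (filter P? (allFin N))) ≤⟨ unique-⊆⇒length≤ unique image⊆ ⟩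
      count Q?                              ∎
      where
        open ≤-Reasoning
        unique : Unique (map f (filter P? (allFin N)))
        unique = Unique.map⁺ f-injective (Unique.filter⁺ P? (Unique.allFin⁺ N))
        image⊆ : ∀ {y} → y ∈ map f (filter P? (allFin N)) → y ∈ filter Q? (allFin N)
        image⊆ y∈ with x , x∈ , refl ← ∈-map⁻ f y∈ =
          ∈-filter⁺ Q? (∈-allFin (f x)) (P⇒Q∘f (proj₂ (∈-filter⁻ P? {xs = allFin N} x∈)))

  module _ {P : Pred (Fin N) 0ℓ} (P? : Decidable P) where

    count-∁ : N ≡ count P? + count (∁? P?)
    count-∁ = trans (sym (length-tabulate {n = N} (λ i → i))) (length-filter-∁ P? (allFin N))

    count-pos : ∀ {x} → P x → 0 < count P?
    count-pos {x} Px = filter-some P? (lose (∈-allFin x) Px)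

  module _ {P Q S : Pred (Fin N) 0ℓ} (P? : Decidable P) (Q? : Decidable Q) (S? : Decidable S)
    where

    count-disjoint : P ⊆ S → Q ⊆ S → P ⊥ Q → count P? + count Q? ≤ count S?
    count-disjoint P⊆S Q⊆S P⊥Q = begin
      count P? + count Q?                    ≤⟨ +-mono-≤ (count-mono P? (S? ∩? P?) in-S∩P)
                                                         (count-mono Q? (S? ∩? ∁? P?) in-S∖P) ⟩
      count (S? ∩? P?) + count (S? ∩? ∁? P?) ≡⟨ count-split S? P? ⟨
      count S?                               ∎
      where
        open ≤-Reasoning
        in-S∩P : P ⊆ S ∩ P
        in-S∩P p = P⊆S p , p
        in-S∖P : Q ⊆ S ∩ ∁ P
        in-S∖P q = Q⊆S q , λ p → P⊥Q (p , q)

  module _ {P Q S : Pred (Fin N) 0ℓ} (P? : Decidable P) (Q? : Decidable Q) (S? : Decidable S)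
    where

    count-inclusion-exclusion : P ⊆ S → Q ⊆ S →
                                count P? + count Q? ≤ count S? + count (P? ∩? Q?)
    count-inclusion-exclusion P⊆S Q⊆S = begin
      count P? + count Q?                                 ≡⟨ cong (count P? +_) (count-split Q? P?) ⟩
      count P? + (count (Q? ∩? P?) + count (Q? ∩? ∁? P?)) ≡⟨ rearrange (count P?) _ _ ⟩
      count P? + count (Q? ∩? ∁? P?) + count (Q? ∩? P?)   ≤⟨ +-mono-≤ P+Q∖P≤S Q∩P≤P∩Q ⟩
      count S? + count (P? ∩? Q?)                         ∎
      where
        open ≤-Reasoning
        rearrange : ∀ a b c → a + (b + c) ≡ a + c + b
        rearrange = solve-∀
        P+Q∖P≤S : count P? + count (Q? ∩? ∁? P?) ≤ count S?
        P+Q∖P≤S = count-disjoint P? (Q? ∩? ∁? P?) S? P⊆S (Q⊆S ∘ proj₁) λ (p , _ , ¬p) → ¬p p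
        Q∩P≤P∩Q : count (Q? ∩? P?) ≤ count (P? ∩? Q?)
        Q∩P≤P∩Q = count-mono (Q? ∩? P?) (P? ∩? Q?) λ (q , p) → p , q

¾-bound : ∀ k s w → 3 * k < 4 * s → s + s ≤ k + w → k < 2 * w
¾-bound k s w 3k<4s 2s≤k+w = ≰⇒> λ 2w≤k → <⇒≱ 3k<4s (begin
  4 * s         ≡⟨ double s ⟩
  2 * (s + s)   ≤⟨ *-monoʳ-≤ 2 2s≤k+w ⟩
  2 * (k + w)   ≡⟨ *-distribˡ-+ 2 k w ⟩
  2 * k + 2 * w ≤⟨ +-monoʳ-≤ (2 * k) 2w≤k ⟩
  2 * k + k     ≡⟨ +-comm (2 * k) k ⟩
  3 * k         ∎)
  where
    open ≤-Reasoning
    double : ∀ t → 4 * t ≡ 2 * (t + t)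
    double = solve-∀

alt1-arithmetic : ∀ {N C I T iA iO tA tO} → N ≡ 2 * C → I ≡ iA + iO → T ≡ tA + tO →
  tA ≤ iA → 4 * tO ≤ 3 * C + 4 * iO → 8 * (N + I + C + T) + N ≤ 16 * (N + I)
alt1-arithmetic {C = C} {iA = iA} {iO} {tA} {tO} refl refl refl tA≤iA 4tO≤3C+4iO =
  subst₂ _≤_ (sym (lhs C iA iO tA tO)) (sym (rhs C iA iO))
    (+-monoʳ-≤ (26 * C + 8 * iA + 8 * iO)
      (+-mono-≤ (*-monoʳ-≤ 8 tA≤iA) (*-monoʳ-≤ 2 4tO≤3C+4iO)))
  where
    lhs : ∀ C iA iO tA tO → 8 * (2 * C + (iA + iO) + C + (tA + tO)) + 2 * C
                          ≡ 26 * C + 8 * iA + 8 * iO + (8 * tA + 2 * (4 * tO))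
    lhs = solve-∀
    rhs : ∀ C iA iO → 16 * (2 * C + (iA + iO))
                    ≡ 26 * C + 8 * iA + 8 * iO + (8 * iA + 2 * (3 * C + 4 * iO))
    rhs = solve-∀

module GroupTheory (G : FinGroup) where

  open FinGroup G using (_∙_; ε; _⁻¹; isGroup)
  open IsGroup isGroup using (assoc; identityˡ; identityʳ; inverseʳ)

  group : Group 0ℓ 0ℓ
  group = record { isGroup = isGroup }

  open GroupProperties group public
    using ( ∙-cancelˡ; ∙-cancelʳ; inverseʳ-unique; ε⁻¹≈ε; ⁻¹-involutive; ⁻¹-injective
          ; ⁻¹-anti-homo-∙; \\-leftDividesˡ; \\-leftDividesʳ; //-rightDividesˡ; //-rightDividesʳ)

  self-inverse⇒involutive : ∀ {a} → a ≡ a ⁻¹ → a ∙ a ≡ ε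
  self-inverse⇒involutive {a} a≡a⁻¹ = trans (cong (a ∙_) a≡a⁻¹) (inverseʳ a)

  commutes-with-∙ : ∀ {a b c} → a ∙ b ≡ b ∙ a → a ∙ c ≡ c ∙ a →
                    a ∙ (b ∙ c) ≡ b ∙ c ∙ a
  commutes-with-∙ {a} {b} {c} ab≡ba ac≡ca = begin
    a ∙ (b ∙ c) ≡⟨ assoc a b c ⟨
    a ∙ b ∙ c   ≡⟨ cong (_∙ c) ab≡ba ⟩
    b ∙ a ∙ c   ≡⟨ assoc b a c ⟩
    b ∙ (a ∙ c) ≡⟨ cong (b ∙_) ac≡ca ⟩
    b ∙ (c ∙ a) ≡⟨ assoc b c a ⟨
    b ∙ c ∙ a   ∎
    where open ≡-Reasoning

  commutes-with-⁻¹ : ∀ {a b} → a ∙ b ≡ b ∙ a → a ∙ b ⁻¹ ≡ b ⁻¹ ∙ a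
  commutes-with-⁻¹ {a} {b} ab≡ba = ∙-cancelˡ b _ _ (begin
    b ∙ (a ∙ b ⁻¹) ≡⟨ assoc b a (b ⁻¹) ⟨
    b ∙ a ∙ b ⁻¹   ≡⟨ cong (_∙ b ⁻¹) ab≡ba ⟨
    a ∙ b ∙ b ⁻¹   ≡⟨ //-rightDividesʳ b a ⟩
    a              ≡⟨ \\-leftDividesˡ b a ⟨
    b ∙ (b ⁻¹ ∙ a) ∎)
    where open ≡-Reasoning

  telescope : ∀ w x y → w ∙ x ⁻¹ ∙ (x ∙ y ⁻¹) ≡ w ∙ y ⁻¹
  telescope w x y =
    trans (sym (assoc (w ∙ x ⁻¹) x (y ⁻¹))) (cong (_∙ y ⁻¹) (//-rightDividesˡ x w))

  IsEndomorphism : (El G → El G) → Set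
  IsEndomorphism φ = ∀ x y → φ (x ∙ y) ≡ φ x ∙ φ y

  module _ {φ : El G → El G} (φ-endo : IsEndomorphism φ) where

    endomorphism-ε : φ ε ≡ ε
    endomorphism-ε = ∙-cancelˡ (φ ε) (φ ε) ε (begin
      φ ε ∙ φ ε ≡⟨ φ-endo ε ε ⟨
      φ (ε ∙ ε) ≡⟨ cong φ (identityˡ ε) ⟩
      φ ε       ≡⟨ identityʳ (φ ε) ⟨
      φ ε ∙ ε   ∎)
      where open ≡-Reasoning

    endomorphism-⁻¹ : ∀ x → φ (x ⁻¹) ≡ φ x ⁻¹
    endomorphism-⁻¹ x = inverseʳ-unique (φ x) (φ (x ⁻¹)) (begin
      φ x ∙ φ (x ⁻¹) ≡⟨ φ-endo x (x ⁻¹) ⟨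
      φ (x ∙ x ⁻¹)   ≡⟨ cong φ (inverseʳ x) ⟩
      φ ε            ≡⟨ endomorphism-ε ⟩
      ε              ∎)
      where open ≡-Reasoning

  conjugate : El G → El G → El G
  conjugate g x = g ∙ x ∙ g ⁻¹

  conjugate-isEndomorphism : ∀ g → IsEndomorphism (conjugate g)
  conjugate-isEndomorphism g x y = begin
    g ∙ (x ∙ y) ∙ g ⁻¹            ≡⟨ cong (_∙ g ⁻¹) (assoc g x y) ⟨
    g ∙ x ∙ y ∙ g ⁻¹              ≡⟨ cong (λ t → t ∙ y ∙ g ⁻¹) (//-rightDividesˡ g (g ∙ x)) ⟨
    g ∙ x ∙ g ⁻¹ ∙ g ∙ y ∙ g ⁻¹   ≡⟨ cong (_∙ g ⁻¹) (assoc (g ∙ x ∙ g ⁻¹) g y) ⟩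
    g ∙ x ∙ g ⁻¹ ∙ (g ∙ y) ∙ g ⁻¹ ≡⟨ assoc (g ∙ x ∙ g ⁻¹) (g ∙ y) (g ⁻¹) ⟩
    g ∙ x ∙ g ⁻¹ ∙ (g ∙ y ∙ g ⁻¹) ∎
    where open ≡-Reasoning

  record IsSubgroup (H : Pred (El G) 0ℓ) : Set where
    field
      ε-closed  : H ε
      ∙-closed  : ∀ {x y} → H x → H y → H (x ∙ y)
      ⁻¹-closed : ∀ {x} → H x → H (x ⁻¹)

    ⁻¹-reflects : ∀ {x} → H (x ⁻¹) → H x
    ⁻¹-reflects {x} Hx⁻¹ = subst H (⁻¹-involutive x) (⁻¹-closed Hx⁻¹)

    ∙-cancelˡ-closed : ∀ {a b} → H a → H (a ∙ b) → H b
    ∙-cancelˡ-closed {a} {b} Ha Hab =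
      subst H (\\-leftDividesʳ a b) (∙-closed (⁻¹-closed Ha) Hab)

    ∙-cancelʳ-closed : ∀ {a b} → H b → H (a ∙ b) → H a
    ∙-cancelʳ-closed {a} {b} Hb Hab =
      subst H (//-rightDividesʳ b a) (∙-closed Hab (⁻¹-closed Hb))

  open IsSubgroup

  Fixed : (El G → El G) → Pred (El G) 0ℓ
  Fixed φ x = φ x ≡ x

  fixed? : ∀ φ → Decidable (Fixed φ)
  fixed? φ x = φ x ≟ x

  Inverted : (El G → El G) → Pred (El G) 0ℓ
  Inverted φ x = φ x ≡ x ⁻¹

  inverted? : ∀ φ → Decidable (Inverted φ)
  inverted? φ x = φ x ≟ x ⁻¹

  Involution : Pred (El G) 0ℓ
  Involution x = x ∙ x ≡ ε

  involution? : Decidable Involution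
  involution? x = x ∙ x ≟ ε

  Centraliser : Pred (El G) 0ℓ → El G → Pred (El G) 0ℓ
  Centraliser K a b = K b × a ∙ b ≡ b ∙ a

  centraliser? : ∀ {K} → Decidable K → ∀ a → Decidable (Centraliser K a)
  centraliser? K? a = K? ∩? λ b → a ∙ b ≟ b ∙ a

  fixed-isSubgroup : ∀ {φ} → IsEndomorphism φ → IsSubgroup (Fixed φ)
  fixed-isSubgroup {φ} φ-endo = record
    { ε-closed  = endomorphism-ε φ-endo
    ; ∙-closed  = λ {x} {y} φx≡x φy≡y → trans (φ-endo x y) (cong₂ _∙_ φx≡x φy≡y)
    ; ⁻¹-closed = λ {x} φx≡x → trans (endomorphism-⁻¹ φ-endo x) (cong _⁻¹ φx≡x)
    }

  centraliser-isSubgroup : ∀ {K} → IsSubgroup K → ∀ a → IsSubgroup (Centraliser K a)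
  centraliser-isSubgroup K-sub a = record
    { ε-closed  = ε-closed K-sub , trans (identityʳ a) (sym (identityˡ a))
    ; ∙-closed  = λ (Kx , ax≡xa) (Ky , ay≡ya) →
                    ∙-closed K-sub Kx Ky , commutes-with-∙ ax≡xa ay≡ya
    ; ⁻¹-closed = λ (Kx , ax≡xa) → ⁻¹-closed K-sub Kx , commutes-with-⁻¹ ax≡xa
    }

  module _ {ψ : El G → El G} (ψ-endo : IsEndomorphism ψ) where

    inverted-commute : ∀ {a b} → Inverted ψ a → Inverted ψ b → Inverted ψ (a ∙ b) →
                       a ∙ b ≡ b ∙ a
    inverted-commute {a} {b} ψa≡a⁻¹ ψb≡b⁻¹ ψab≡ab⁻¹ = ⁻¹-injective (begin
      (a ∙ b) ⁻¹  ≡⟨ ψab≡ab⁻¹ ⟨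
      ψ (a ∙ b)   ≡⟨ ψ-endo a b ⟩
      ψ a ∙ ψ b   ≡⟨ cong₂ _∙_ ψa≡a⁻¹ ψb≡b⁻¹ ⟩
      a ⁻¹ ∙ b ⁻¹ ≡⟨ ⁻¹-anti-homo-∙ b a ⟨
      (b ∙ a) ⁻¹  ∎)
      where open ≡-Reasoning

    inverted-isSubgroup : ∀ {K} → IsSubgroup K →
      (∀ {a b} → (K ∩ Inverted ψ) a → (K ∩ Inverted ψ) b → a ∙ b ≡ b ∙ a) →
      IsSubgroup (K ∩ Inverted ψ)
    inverted-isSubgroup K-sub commute = record
      { ε-closed  = ε-closed K-sub , trans (endomorphism-ε ψ-endo) (sym ε⁻¹≈ε)
      ; ∙-closed  = λ {a} {b} Sa Sb → ∙-closed K-sub (proj₁ Sa) (proj₁ Sb) , (begin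
          ψ (a ∙ b)   ≡⟨ ψ-endo a b ⟩
          ψ a ∙ ψ b   ≡⟨ cong₂ _∙_ (proj₂ Sa) (proj₂ Sb) ⟩
          a ⁻¹ ∙ b ⁻¹ ≡⟨ ⁻¹-anti-homo-∙ b a ⟨
          (b ∙ a) ⁻¹  ≡⟨ cong _⁻¹ (commute Sb Sa) ⟩
          (a ∙ b) ⁻¹  ∎)
      ; ⁻¹-closed = λ {a} Sa → ⁻¹-closed K-sub (proj₁ Sa) ,
          trans (endomorphism-⁻¹ ψ-endo a) (cong _⁻¹ (proj₂ Sa))
      }
      where open ≡-Reasoning

  more-than-half⇒⊇ : ∀ {H K} (H? : Decidable H) (K? : Decidable K) →
    IsSubgroup H → IsSubgroup K → H ⊆ K → count K? < 2 * count H? → K ⊆ H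
  more-than-half⇒⊇ {H} {K} H? K? H-sub K-sub H⊆K K<2H {b} Kb with H? b
  ... | yes Hb = Hb
  ... | no b∉H = ⊥-elim (<⇒≱ K<2H (begin
    2 * count H?                            ≡⟨ cong (count H? +_) (+-identityʳ (count H?)) ⟩
    count H? + count H?                     ≤⟨ +-mono-≤ H≤K∩H H≤K∖H ⟩
    count (K? ∩? H?) + count (K? ∩? ∁? H?) ≡⟨ count-split K? H? ⟨
    count K?                                ∎))
    where
      open ≤-Reasoning
      H≤K∩H : count H? ≤ count (K? ∩? H?)
      H≤K∩H = count-mono H? (K? ∩? H?) λ h → H⊆K h , h
      H≤K∖H : count H? ≤ count (K? ∩? ∁? H?)
      H≤K∖H = count-injective H? (K? ∩? ∁? H?) (b ∙_) (∙-cancelˡ b _ _)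
        λ Hh → ∙-closed K-sub Kb (H⊆K Hh) , λ Hbh → b∉H (∙-cancelʳ-closed H-sub Hh Hbh)

  index-two⇒outer-coset : ∀ {A} (A? : Decidable A) → IsSubgroup A →
    FinGroup.n G ≡ 2 * count A? → ∀ {x y} → ¬ A x → ¬ A y → A (x ∙ y ⁻¹)
  index-two⇒outer-coset {A} A? A-sub |G|≡2|A| {x} {y} x∉A y∉A with A? (x ∙ y ⁻¹)
  ... | yes xy⁻¹∈A = xy⁻¹∈A
  ... | no  xy⁻¹∉A =
    ⊥-elim (<⇒≱ (count-pos A? (ε-closed A-sub)) (+-cancelˡ-≤ |A| |A| 0 (begin
      |A| + |A|                           ≤⟨ +-mono-≤ (coset-large x) (coset-large y) ⟩
      count (coset? x) + count (coset? y) ≤⟨ cosets≤outside ⟩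
      count (∁? A?)                       ≡⟨ |∁A|≡|A| ⟩
      |A|                                 ≡⟨ +-identityʳ |A| ⟨
      |A| + 0                             ∎)))
    where
      open ≤-Reasoning
      |A| : ℕ
      |A| = count A?
      |∁A|≡|A| : count (∁? A?) ≡ |A|
      |∁A|≡|A| = +-cancelˡ-≡ |A| _ _
        (trans (sym (count-∁ A?)) (trans |G|≡2|A| (cong (|A| +_) (+-identityʳ |A|))))
      coset? : ∀ z → Decidable (λ w → A (w ∙ z ⁻¹))
      coset? z w = A? (w ∙ z ⁻¹)
      coset-large : ∀ z → |A| ≤ count (coset? z)
      coset-large z = count-injective A? (coset? z) (_∙ z) (∙-cancelʳ z _ _)
        λ {a} Aa → subst A (sym (//-rightDividesʳ z a)) Aa
      coset-outside : ∀ {z} → ¬ A z → (λ w → A (w ∙ z ⁻¹)) ⊆ ∁ A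
      coset-outside z∉A Awz⁻¹ Aw =
        z∉A (⁻¹-reflects A-sub (∙-cancelˡ-closed A-sub Aw Awz⁻¹))
      cosets-disjoint : (λ w → A (w ∙ x ⁻¹)) ⊥ (λ w → A (w ∙ y ⁻¹))
      cosets-disjoint {w} (Awx⁻¹ , Awy⁻¹) =
        xy⁻¹∉A (∙-cancelˡ-closed A-sub Awx⁻¹ (subst A (sym (telescope w x y)) Awy⁻¹))
      cosets≤outside : count (coset? x) + count (coset? y) ≤ count (∁? A?)
      cosets≤outside = count-disjoint (coset? x) (coset? y) (∁? A?)
        (coset-outside x∉A) (coset-outside y∉A) cosets-disjoint

  module _ {K : Pred (El G) 0ℓ} {ψ : El G → El G}
           (K? : Decidable K) (K-sub : IsSubgroup K) (ψ-endo : IsEndomorphism ψ)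
           (big : 3 * count K? < 4 * count (K? ∩? inverted? ψ)) where

    private
      S? : Decidable (K ∩ Inverted ψ)
      S? = K? ∩? inverted? ψ
      S⊆K : K ∩ Inverted ψ ⊆ K
      S⊆K = proj₁

    inverting-¾⇒centralising : ∀ {a b} → (K ∩ Inverted ψ) a → K b → a ∙ b ≡ b ∙ a
    inverting-¾⇒centralising {a} Sa = proj₂ ∘
      more-than-half⇒⊇ (centraliser? K? a) K? (centraliser-isSubgroup K-sub a) K-sub proj₁ K<2Z
      where
        a·S? : Decidable (λ b → (K ∩ Inverted ψ) (a ∙ b))
        a·S? b = S? (a ∙ b)
        S≤a·S : count S? ≤ count a·S?
        S≤a·S = count-injective S? a·S? (a ⁻¹ ∙_) (∙-cancelˡ (a ⁻¹) _ _)
          λ {s} Ss → subst (K ∩ Inverted ψ) (sym (\\-leftDividesˡ a s)) Ss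
        a·S⊆K : (λ b → (K ∩ Inverted ψ) (a ∙ b)) ⊆ K
        a·S⊆K aSb = ∙-cancelˡ-closed K-sub (proj₁ Sa) (proj₁ aSb)
        S∩a·S⊆Z : (K ∩ Inverted ψ) ∩ (λ b → (K ∩ Inverted ψ) (a ∙ b)) ⊆ Centraliser K a
        S∩a·S⊆Z ((Kb , ψb) , (_ , ψab)) = Kb , inverted-commute ψ-endo (proj₂ Sa) ψb ψab
        K<2Z : count K? < 2 * count (centraliser? K? a)
        K<2Z = ¾-bound (count K?) (count S?) (count (centraliser? K? a)) big (begin
          count S? + count S?                  ≤⟨ +-monoʳ-≤ (count S?) S≤a·S ⟩
          count S? + count a·S?                ≤⟨ count-inclusion-exclusion S? a·S? K? S⊆K a·S⊆K ⟩
          count K? + count (S? ∩? a·S?)        ≤⟨ +-monoʳ-≤ (count K?)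
                                                    (count-mono _ (centraliser? K? a) S∩a·S⊆Z) ⟩
          count K? + count (centraliser? K? a) ∎)
          where open ≤-Reasoning

    inverting-¾⇒inverting : K ⊆ Inverted ψ
    inverting-¾⇒inverting = proj₂ ∘ more-than-half⇒⊇ S? K? S-sub K-sub S⊆K
      (¾-bound (count K?) (count S?) (count S?) big (+-monoˡ-≤ (count S?) (count-mono S? K? S⊆K)))
      where
        S-sub : IsSubgroup (K ∩ Inverted ψ)
        S-sub = inverted-isSubgroup ψ-endo K-sub λ Sa Sb → inverting-¾⇒centralising Sa (proj₁ Sb)

    inverting-¾⇒abelian : ∀ {a b} → K a → K b → a ∙ b ≡ b ∙ a
    inverting-¾⇒abelian Ka = inverting-¾⇒centralising (Ka , inverting-¾⇒inverting Ka)

  module _ {A : Pred (El G) 0ℓ} (A? : Decidable A) {x : El G}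
           (cover : ∀ {z} → ¬ A z → A (z ∙ x ⁻¹)) where

    commutes-with-A-and-x⇒central : ∀ {g} → (∀ {a} → A a → g ∙ a ≡ a ∙ g) →
                                     g ∙ x ≡ x ∙ g → ∀ z → g ∙ z ≡ z ∙ g
    commutes-with-A-and-x⇒central gA≡Ag gx≡xg z with A? z
    ... | yes Az  = gA≡Ag Az
    ... | no  z∉A = subst (λ w → _ ∙ w ≡ w ∙ _) (//-rightDividesˡ x z)
                      (commutes-with-∙ (gA≡Ag (cover z∉A)) gx≡xg)

    abelian-over-index-two : (∀ {a b} → A a → A b → a ∙ b ≡ b ∙ a) →
                             (∀ {a} → A a → a ∙ x ≡ x ∙ a) → ∀ z w → z ∙ w ≡ w ∙ z
    abelian-over-index-two A-abelian x-centralises-A z =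
      central (λ Aa → sym (A-central Aa z)) (sym (x-central z))
      where
        central : ∀ {g} → (∀ {a} → A a → g ∙ a ≡ a ∙ g) → g ∙ x ≡ x ∙ g →
                  ∀ z → g ∙ z ≡ z ∙ g
        central = commutes-with-A-and-x⇒central
        A-central : ∀ {a} → A a → ∀ z → a ∙ z ≡ z ∙ a
        A-central Aa = central (A-abelian Aa) (x-centralises-A Aa)
        x-central : ∀ z → x ∙ z ≡ z ∙ x
        x-central = central (λ Aa → sym (x-centralises-A Aa)) refl

module _ (R : FinGroup) (φ : El R → El R) (φ-endo : GroupTheory.IsEndomorphism R φ)
         (index : n R ≡ 2 * centCount R φ) where

  open FinGroup R using (_∙_; ε; _⁻¹; isGroup)
  open IsGroup isGroup using (assoc)
  open GroupTheory R
  open IsSubgroup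

  private
    A : Pred (El R) 0ℓ
    A = Fixed φ
    A? : Decidable A
    A? = fixed? φ
    A-sub : IsSubgroup A
    A-sub = fixed-isSubgroup φ-endo

  outer-coset : ∀ {x y} → ¬ A x → ¬ A y → A (x ∙ y ⁻¹)
  outer-coset = index-two⇒outer-coset A? A-sub index

  alt1-criterion : 4 * count (inverted? φ ∩? ∁? A?) ≤ 3 * count A? + 4 * count (involution? ∩? ∁? A?) →
                   Alt1 R φ
  alt1-criterion =
    alt1-arithmetic index (count-split involution? A?) (count-split (inverted? φ) A?)
      (count-mono (inverted? φ ∩? A?) (involution? ∩? A?)
        λ (φx≡x⁻¹ , φx≡x) → self-inverse⇒involutive (trans (sym φx≡x) φx≡x⁻¹) , φx≡x)

  alt1-if-outer-inverted-are-involutions : Inverted φ ∖ A ⊆ Involution ∖ A → Alt1 R φ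
  alt1-if-outer-inverted-are-involutions ⊆ = alt1-criterion (≤-trans
    (*-monoʳ-≤ 4 (count-mono (inverted? φ ∩? ∁? A?) (involution? ∩? ∁? A?) ⊆))
    (m≤n+m _ (3 * count A?)))

  module InvertedOutside {x} (x-inverted : Inverted φ x) (x∉A : ¬ A x) where

    private
      ψ : El R → El R
      ψ = conjugate x
      S? : Decidable (A ∩ Inverted ψ)
      S? = A? ∩? inverted? ψ

    φ-on-coset : ∀ {a} → A a → φ (a ∙ x) ≡ a ∙ x ⁻¹
    φ-on-coset {a} φa≡a = trans (φ-endo a x) (cong₂ _∙_ φa≡a x-inverted)

    coset-inverted⇒ : ∀ {a} → A a → Inverted φ (a ∙ x) → Inverted ψ a
    coset-inverted⇒ {a} Aa φax≡ax⁻¹ = begin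
      x ∙ a ∙ x ⁻¹      ≡⟨ assoc x a (x ⁻¹) ⟩
      x ∙ (a ∙ x ⁻¹)    ≡⟨ cong (x ∙_) (φ-on-coset Aa) ⟨
      x ∙ φ (a ∙ x)     ≡⟨ cong (x ∙_) (trans φax≡ax⁻¹ (⁻¹-anti-homo-∙ a x)) ⟩
      x ∙ (x ⁻¹ ∙ a ⁻¹) ≡⟨ \\-leftDividesˡ x (a ⁻¹) ⟩
      a ⁻¹              ∎
      where open ≡-Reasoning

    coset-inverted⇐ : ∀ {a} → A a → Inverted ψ a → Inverted φ (a ∙ x)
    coset-inverted⇐ {a} Aa ψa≡a⁻¹ = begin
      φ (a ∙ x)               ≡⟨ φ-on-coset Aa ⟩
      a ∙ x ⁻¹                ≡⟨ \\-leftDividesʳ x (a ∙ x ⁻¹) ⟨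
      x ⁻¹ ∙ (x ∙ (a ∙ x ⁻¹)) ≡⟨ cong (x ⁻¹ ∙_) (trans (sym (assoc x a (x ⁻¹))) ψa≡a⁻¹) ⟩
      x ⁻¹ ∙ a ⁻¹             ≡⟨ ⁻¹-anti-homo-∙ a x ⟨
      (a ∙ x) ⁻¹              ∎
      where open ≡-Reasoning

    outer-inverted≤S : count (inverted? φ ∩? ∁? A?) ≤ count S?
    outer-inverted≤S =
      count-injective (inverted? φ ∩? ∁? A?) S? (_∙ x ⁻¹) (∙-cancelʳ (x ⁻¹) _ _)
        λ {z} (φz≡z⁻¹ , z∉A) → let Az/x = outer-coset z∉A x∉A in
          Az/x , coset-inverted⇒ Az/x (subst (Inverted φ) (sym (//-rightDividesˡ x z)) φz≡z⁻¹)

    module MostlyInverting (big : 3 * count A? < 4 * count S?) where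

      A-abelian : ∀ {a b} → A a → A b → a ∙ b ≡ b ∙ a
      A-abelian = inverting-¾⇒abelian A? A-sub (conjugate-isEndomorphism x) big

      ψ-inverts-A : A ⊆ Inverted ψ
      ψ-inverts-A = inverting-¾⇒inverting A? A-sub (conjugate-isEndomorphism x) big

      x-twists : ∀ {a} → A a → x ∙ a ≡ a ⁻¹ ∙ x
      x-twists {a} Aa =
        trans (sym (//-rightDividesˡ x (x ∙ a))) (cong (_∙ x) (ψ-inverts-A Aa))

      outer-inverted : ∀ {z} → ¬ A z → Inverted φ z
      outer-inverted {z} z∉A =
        subst (Inverted φ) (//-rightDividesˡ x z) (coset-inverted⇐ Az/x (ψ-inverts-A Az/x))
        where
          Az/x : A (z ∙ x ⁻¹)
          Az/x = outer-coset z∉A x∉A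

      outer-involutions : Involution x → ∀ {z} → ¬ A z → Involution z
      outer-involutions x²≡ε {z} z∉A = subst Involution (//-rightDividesˡ x z) (begin
        a ∙ x ∙ (a ∙ x)    ≡⟨ assoc (a ∙ x) a x ⟨
        a ∙ x ∙ a ∙ x      ≡⟨ cong (_∙ x) (assoc a x a) ⟩
        a ∙ (x ∙ a) ∙ x    ≡⟨ cong (λ t → a ∙ t ∙ x) (x-twists (outer-coset z∉A x∉A)) ⟩
        a ∙ (a ⁻¹ ∙ x) ∙ x ≡⟨ cong (_∙ x) (\\-leftDividesˡ a x) ⟩
        x ∙ x              ≡⟨ x²≡ε ⟩
        ε                  ∎)
        where
          open ≡-Reasoning
          a : El R
          a = z ∙ x ⁻¹

      alt2 : ¬ Involution x → (∃ λ w → A w × ¬ Involution w) → Alt2 R φ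
      alt2 x²≢ε non-involution = (λ _ _ → A-abelian) , non-involution ,
        (x , x∉A , x²∈A , x²≢ε , x⁴≡ε , (λ _ → conjugation-inverts) , (λ _ Aa → Aa) ,
         λ _ → φ-on-coset)
        where
          x²∈A : A (x ∙ x)
          x²∈A = subst A (cong (x ∙_) (⁻¹-involutive x))
                   (outer-coset x∉A (x∉A ∘ ⁻¹-reflects A-sub))
          ψx²≡x² : ψ (x ∙ x) ≡ x ∙ x
          ψx²≡x² = trans (cong (_∙ x ⁻¹) (sym (assoc x x x))) (//-rightDividesʳ x (x ∙ x))
          x⁴≡ε : Involution (x ∙ x)
          x⁴≡ε = self-inverse⇒involutive (trans (sym ψx²≡x²) (ψ-inverts-A x²∈A))
          conjugation-inverts : ∀ {a} → A a → x ⁻¹ ∙ a ∙ x ≡ a ⁻¹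
          conjugation-inverts {a} Aa = begin
            x ⁻¹ ∙ a ∙ x         ≡⟨ assoc (x ⁻¹) a x ⟩
            x ⁻¹ ∙ (a ∙ x)       ≡⟨ cong (λ t → x ⁻¹ ∙ (t ∙ x)) (⁻¹-involutive a) ⟨
            x ⁻¹ ∙ (a ⁻¹ ⁻¹ ∙ x) ≡⟨ cong (x ⁻¹ ∙_) (x-twists (⁻¹-closed A-sub Aa)) ⟨
            x ⁻¹ ∙ (x ∙ a ⁻¹)    ≡⟨ \\-leftDividesʳ x (a ⁻¹) ⟩
            a ⁻¹                 ∎
            where open ≡-Reasoning

      alt3 : ¬ Involution x → A ⊆ Involution → Alt3 R φ
      alt3 x²≢ε A⊆I =
        abelian-over-index-two A? (λ z∉A → outer-coset z∉A x∉A) A-abelian x-centralises-A ,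
        (x , x²≢ε) , φ-inverts
        where
          self-inverse : ∀ {a} → A a → a ≡ a ⁻¹
          self-inverse {a} Aa = inverseʳ-unique a a (A⊆I Aa)
          x-centralises-A : ∀ {a} → A a → a ∙ x ≡ x ∙ a
          x-centralises-A Aa = sym (trans (x-twists Aa) (cong (_∙ x) (sym (self-inverse Aa))))
          φ-inverts : ∀ z → Inverted φ z
          φ-inverts z with A? z
          ... | yes Az  = trans Az (self-inverse Az)
          ... | no  z∉A = outer-inverted z∉A

    trichotomy : Alt1 R φ ⊎ Alt2 R φ ⊎ Alt3 R φ
    trichotomy with 4 * count S? ≤? 3 * count A?
    ... | yes few = inj₁ (alt1-criterion
                      (≤-trans (*-monoʳ-≤ 4 outer-inverted≤S) (≤-trans few (m≤m+n _ _))))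
    ... | no  many with ≰⇒> many | involution? x | any? (A? ∩? ∁? involution?)
    ...   | big | yes x²≡ε | _ = inj₁ (alt1-if-outer-inverted-are-involutions
            λ (_ , z∉A) → MostlyInverting.outer-involutions big x²≡ε z∉A , z∉A)
    ...   | big | no  x²≢ε | yes non-involution =
            inj₂ (inj₁ (MostlyInverting.alt2 big x²≢ε non-involution))
    ...   | big | no  x²≢ε | no  none =
            inj₂ (inj₂ (MostlyInverting.alt3 big x²≢ε λ {a} Aa →
              decidable-stable (involution? a) λ a²≢ε → none (a , Aa , a²≢ε)))

lemma2p5 : (R : FinGroup) (φ : El R → El R) → IsAutomorphism R φ →
    n R ≡ 2 * centCount R φ →
    Alt1 R φ ⊎ Alt2 R φ ⊎ Alt3 R φ
lemma2p5 R φ (φ-endo , _) index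
  with any? (GroupTheory.inverted? R φ ∩? ∁? (GroupTheory.fixed? R φ))
... | no  none = inj₁ (alt1-if-outer-inverted-are-involutions R φ φ-endo index
                        λ {x} outer-inverted → ⊥-elim (none (x , outer-inverted)))
... | yes (x , x-inverted , x∉A) = InvertedOutside.trichotomy R φ φ-endo index x-inverted x∉A
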